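{- Let $X$ and $Y$ be disjoint sets of Boolean variables, let $F(X,Y)$ be a CNF formula over the variables $X \cup Y$, and let $G$ be a non-empty subset of the clauses of $F$. Then $\exists X\,[F] \equiv \exists X\,[F \setminus G]$ (i.e. $G$ is redundant in $\exists X\,[F]$) if and only if every $G$-boundary point of $F$ (if any) is $Y$-unremovable.
   Context: A CNF formula is identified with its set of clauses, so $F \setminus G$ is the conjunction of the clauses of $F$ not in $G$. For formulas possibly containing existential quantifiers, $A \equiv B$ means that $A$ and $B$ take the same truth value under every full assignment to their free variables; here, for every full assignment $\vec{y}$ to $Y$, $\exists X\,[F]$ is true iff some assignment to $X$ together with $\vec{y}$ satisfies $F$. A $G$-boundary point of $F$ is a full assignment $(\vec{x},\vec{y})$ to $X \cup Y$ (with $\vec{x}$ a full assignment to $X$ and $\vec{y}$ a full assignment to $Y$) that falsifies the formula $G$ (i.e. falsifies at least one clause of $G$) and satisfies every clause of $F \setminus G$. Such a point is called $Y$-removable if $F_{\vec{y}}$ is unsatisfiable, and $Y$-unremovable if $F_{\vec{y}}$ is satisfiable, where $F_{\vec{y}}$ denotes the formula obtained from $F$ by substituting the values of $\vec{y}$ (removing clauses satisfied by $\vec{y}$ and deleting literals falsified by $\vec{y}$ from the remaining clauses), i.e. $F_{\vec{y}}$ is satisfiable iff some assignment to $X$ together with $\vec{y}$ satisfies $F$. -}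

module Defs where

open import Data.Nat using (ℕ)
open import Data.Fin using (Fin)
open import Data.Bool using (Bool; true; false; T)
open import Data.Sum using (_⊎_; inj₁; inj₂)
open import Data.Product using (_×_; _,_; ∃; Σ)
open import Data.List using (List)
open import Data.List.Membership.Propositional using (_∈_)
open import Data.List.Relation.Unary.Any using (Any)
open import Relation.Nullary using (¬_)
open import Relation.Binary.PropositionalEquality using (_≡_)
open import Function.Bundles using (_⇔_)

-- Variables: X = Fin n (inj₁), Y = Fin m (inj₂); disjoint by construction.
Var : ℕ → ℕ → Set
Var n m = Fin n ⊎ Fin m

-- A literal: a variable with a polarity (true = positive, false = negated).
Literal : ℕ → ℕ → Set
Literal n m = Var n m × Bool

Clause : ℕ → ℕ → Set
Clause n m = List (Literal n m)

-- A CNF formula, identified with its (finite) set of clauses.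
CNF : ℕ → ℕ → Set
CNF n m = List (Clause n m)

AssignX : ℕ → Set
AssignX n = Fin n → Bool

AssignY : ℕ → Set
AssignY m = Fin m → Bool

value : ∀ {n m} → AssignX n → AssignY m → Var n m → Bool
value x y (inj₁ i) = x i
value x y (inj₂ j) = y j

SatLit : ∀ {n m} → AssignX n → AssignY m → Literal n m → Set
SatLit x y (v , b) = value x y v ≡ b

SatClause : ∀ {n m} → AssignX n → AssignY m → Clause n m → Set
SatClause x y C = Any (SatLit x y) C

SatDiff : ∀ {n m} → AssignX n → AssignY m → CNF n m → CNF n m → Set
SatDiff x y F G = ∀ C → C ∈ F → ¬ (C ∈ G) → SatClause x y C

SatCNF : ∀ {n m} → AssignX n → AssignY m → CNF n m → Set
SatCNF x y F = ∀ C → C ∈ F → SatClause x y C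

FalsifiesCNF : ∀ {n m} → AssignX n → AssignY m → CNF n m → Set
FalsifiesCNF x y G = Σ _ λ C → C ∈ G × ¬ SatClause x y C

ExistsX : ∀ {n m} → CNF n m → AssignY m → Set
ExistsX {n} F y = ∃ λ (x : AssignX n) → SatCNF x y F

ExistsXDiff : ∀ {n m} → CNF n m → CNF n m → AssignY m → Set
ExistsXDiff {n} F G y = ∃ λ (x : AssignX n) → SatDiff x y F G

Redundant : ∀ {n m} → CNF n m → CNF n m → Set
Redundant {m = m} F G = ∀ (y : AssignY m) → ExistsX F y ⇔ ExistsXDiff F G y

BoundaryPoint : ∀ {n m} → CNF n m → CNF n m → AssignX n → AssignY m → Set
BoundaryPoint F G x y = FalsifiesCNF x y G × SatDiff x y F G

YUnremovable : ∀ {n m} → CNF n m → AssignY m → Set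
YUnremovable F y = ExistsX F y

_⊆ᶜ_ : ∀ {n m} → CNF n m → CNF n m → Set
G ⊆ᶜ F = ∀ C → C ∈ G → C ∈ F

{-# OPTIONS --safe #-}
module Submission where

open import Defs
open import Data.Nat using (ℕ)
open import Data.Bool using () renaming (_≟_ to _≟ᵇ_)
open import Data.Empty using (⊥-elim)
open import Data.Fin.Properties using () renaming (_≟_ to _≟ᶠ_)
open import Data.List using ([])
open import Data.List.Membership.Propositional using (_∈_; find)
import Data.List.Membership.DecPropositional as DecMembership
open import Data.List.Properties using () renaming (≡-dec to List-≡-dec)
open import Data.List.Relation.Unary.All as All using (all?)
open import Data.List.Relation.Unary.All.Properties using (¬All⇒Any¬)
open import Data.List.Relation.Unary.Any using (any?)
open import Data.Product using (_,_)
open import Data.Product.Properties using () renaming (≡-dec to ×-≡-dec)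
open import Data.Sum using (_⊎_; inj₁; inj₂)
open import Data.Sum.Properties using () renaming (≡-dec to ⊎-≡-dec)
open import Function.Bundles using (_⇔_; mk⇔; Equivalence)
open import Relation.Binary.Definitions using (DecidableEquality)
open import Relation.Binary.PropositionalEquality using (_≡_)
open import Relation.Nullary using (¬_; Dec; yes; no)

-- An X-witness for F ∖ G that is not one for F falsifies a clause of F, which
-- must lie in G: it is a boundary point.  So redundancy fails exactly at the y
-- of boundary points with F_y unsatisfiable.

_≟ˡ_ : ∀ {n m} → DecidableEquality (Literal n m)
_≟ˡ_ = ×-≡-dec (⊎-≡-dec _≟ᶠ_ _≟ᶠ_) _≟ᵇ_

_≟ᶜ_ : ∀ {n m} → DecidableEquality (Clause n m)
_≟ᶜ_ = List-≡-dec _≟ˡ_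

_∈ᶜ?_ : ∀ {n m} (C : Clause n m) (F : CNF n m) → Dec (C ∈ F)
_∈ᶜ?_ = DecMembership._∈?_ _≟ᶜ_

satClause? : ∀ {n m} (x : AssignX n) (y : AssignY m) (C : Clause n m) → Dec (SatClause x y C)
satClause? x y = any? (λ { (v , b) → value x y v ≟ᵇ b })

satCNF⊎falsifiesCNF : ∀ {n m} (x : AssignX n) (y : AssignY m) (F : CNF n m) →
  SatCNF x y F ⊎ FalsifiesCNF x y F
satCNF⊎falsifiesCNF x y F with all? (satClause? x y) F
... | yes sat = inj₁ (λ _ → All.lookup sat)
... | no ¬sat = inj₂ (find (¬All⇒Any¬ (satClause? x y) F ¬sat))

satCNF⇒satDiff : ∀ {n m} {x : AssignX n} {y : AssignY m} {F : CNF n m} (G : CNF n m) →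
  SatCNF x y F → SatDiff x y F G
satCNF⇒satDiff G sat C C∈F _ = sat C C∈F

satDiff⇒satCNF⊎boundaryPoint : ∀ {n m} {x : AssignX n} {y : AssignY m} {F G : CNF n m} →
  SatDiff x y F G → SatCNF x y F ⊎ BoundaryPoint F G x y
satDiff⇒satCNF⊎boundaryPoint {x = x} {y} {F} {G} satDiff with satCNF⊎falsifiesCNF x y F
... | inj₁ sat = inj₁ sat
... | inj₂ (C , C∈F , ¬satC) with C ∈ᶜ? G
...   | yes C∈G = inj₂ ((C , C∈G , ¬satC) , satDiff)
...   | no C∉G = ⊥-elim (¬satC (satDiff C C∈F C∉G))

proposition3 : (n m : ℕ) (F G : CNF n m) → G ⊆ᶜ F → ¬ (G ≡ []) →
    Redundant F G ⇔ (∀ (x : AssignX n) (y : AssignY m) → BoundaryPoint F G x y → YUnremovable F y)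
proposition3 n m F G _ _ = mk⇔ boundaryPointsUnremovable redundant
  where
  boundaryPointsUnremovable : Redundant F G → ∀ x y → BoundaryPoint F G x y → YUnremovable F y
  boundaryPointsUnremovable red x y (_ , satDiff) = Equivalence.from (red y) (x , satDiff)

  redundant : (∀ x y → BoundaryPoint F G x y → YUnremovable F y) → Redundant F G
  redundant unremovable y = mk⇔ (λ { (x , sat) → x , satCNF⇒satDiff G sat }) witnessF
    where
    witnessF : ExistsXDiff F G y → ExistsX F y
    witnessF (x , satDiff) with satDiff⇒satCNF⊎boundaryPoint satDiff
    ... | inj₁ sat = x , sat
    ... | inj₂ boundary = unremovable x y boundary
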